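{- If the standard sequent $\Gamma\vdash\Delta$ is derivable in $\mathbf{LBiI}$, then the labelled sequent $x:\Gamma\vdash_{\{x\}}x:\Delta$ is derivable in $\mathbf{L}\text{ - }\mathbf{LBiI}$.
   Context: Formulas: $A,B ::= p \mid \top \mid \bot \mid A\wedge B \mid A \vee B \mid A \supset B \mid A \mathbin{ -\!\!<} B$ ($p$ propositional variables; $\mathbin{ -\!\!<}$ is exclusion). $\mathbf{LBiI}$: sequents $\Gamma\vdash\Delta$ with $\Gamma,\Delta$ finite multisets of formulas. Rules (premises $\Rightarrow$ conclusion): hyp: $\Gamma,A\vdash A,\Delta$; cut: $\Gamma\vdash A,\Delta$ and $\Gamma,A\vdash\Delta\Rightarrow\Gamma\vdash\Delta$; weakL/R: $\Gamma\vdash\Delta\Rightarrow\Gamma,A\vdash\Delta$ / $\Gamma\vdash A,\Delta$; contrL/R: $\Gamma,A,A\vdash\Delta\Rightarrow\Gamma,A\vdash\Delta$ / $\Gamma\vdash A,A,\Delta\Rightarrow\Gamma\vdash A,\Delta$; $\top$L: $\Gamma\vdash\Delta\Rightarrow\Gamma,\top\vdash\Delta$; $\top$R: $\Gamma\vdash\top,\Delta$; $\bot$L: $\Gamma,\bot\vdash\Delta$; $\bot$R: $\Gamma\vdash\Delta\Rightarrow\Gamma\vdash\bot,\Delta$; $\wedge$L: $\Gamma,A,B\vdash\Delta\Rightarrow\Gamma,A\wedge B\vdash\Delta$; $\wedge$R: $\Gamma\vdash A,\Delta$ and $\Gamma\vdash B,\Delta\Rightarrow\Gamma\vdash A\wedge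 B,\Delta$; $\vee$L: $\Gamma,A\vdash\Delta$ and $\Gamma,B\vdash\Delta\Rightarrow\Gamma,A\vee B\vdash\Delta$; $\vee$R: $\Gamma\vdash A,B,\Delta\Rightarrow\Gamma\vdash A\vee B,\Delta$; $\supset$L: $\Gamma,A\supset B\vdash A,\Delta$ and $\Gamma,B\vdash\Delta\Rightarrow\Gamma,A\supset B\vdash\Delta$; $\supset$R: $\Gamma,A\vdash B\Rightarrow\Gamma\vdash A\supset B,\Delta$; $\mathbin{ -\!\!<}$L: $A\vdash B,\Delta\Rightarrow\Gamma,A\mathbin{ -\!\!<}B\vdash\Delta$; $\mathbin{ -\!\!<}$R: $\Gamma\vdash A,\Delta$ and $\Gamma,B\vdash A\mathbin{ -\!\!<}B,\Delta\Rightarrow\Gamma\vdash A\mathbin{ -\!\!<}B,\Delta$. Label trees: finite directed graphs $G$ with nonempty node set $\mathrm{nodes}(G)$ in which any two nodes are connected by exactly one path of forward/backward arcs; $xGy$ means an arc $x\to y$. $\{x\}$ is the one-node tree, $(x,y)$ the tree with one arc $x\to y$, $G\oplus_x G'$ (defined only if $\mathrm{nodes}(G)\cap\mathrm{nodes}(G')=\{x\}$) the union; $G[y/x]$, $\Gamma[y/x]$ rename $x$ to $y$. A labelled sequent $\Gamma\vdash_G\Delta$ has $\Gamma,\Delta$ finite multisets of labelled formulas $x:A$, $x\in\mathrm{nodes}(G)$; for a multiset of formulas $\Gamma$, $x:\Gamma$ labels every member with $x$. Rules of $\mathbf{L}\text{ - }\mathbf{LBiI}$ (well-definedness of every $\oplus$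 is a proviso): hyp: $\Gamma,x:A\vdash_G x:A,\Delta$; cut: $\Gamma\vdash_G x:A,\Delta$ and $\Gamma,x:A\vdash_G\Delta\Rightarrow\Gamma\vdash_G\Delta$; weakL/R, contrL/R on labelled formulas; nodesplitU: if no $z$ has $zGx$, $\Gamma\vdash_{G_0\oplus_y G[y/x]}\Delta\Rightarrow\Gamma\vdash_{G_0\oplus_y(y,x)\oplus_x G}\Delta$; nodesplitD: if no $z$ has $xGz$, $\Gamma\vdash_{G[y/x]\oplus_y G_0}\Delta\Rightarrow\Gamma\vdash_{G\oplus_x(x,y)\oplus_y G_0}\Delta$; nodemergeD: $\Gamma\vdash_{G_0\oplus_y(y,x)\oplus_x G}\Delta\Rightarrow\Gamma[x/y]\vdash_{G_0[x/y]\oplus_x G}\Delta[x/y]$; nodemergeU: $\Gamma\vdash_{G\oplus_x(x,y)\oplus_y G_0}\Delta\Rightarrow\Gamma[x/y]\vdash_{G\oplus_x G_0[x/y]}\Delta[x/y]$; monotL: if $xGy$, $\Gamma,x:A,y:A\vdash_G\Delta\Rightarrow\Gamma,x:A\vdash_G\Delta$; monotR: if $yGx$, $\Gamma\vdash_G y:A,x:A,\Delta\Rightarrow\Gamma\vdash_G x:A,\Delta$; $\top$L, $\top$R, $\bot$L, $\bot$R, $\wedge$L, $\wedge$R, $\vee$L, $\vee$R, $\supset$L, $\mathbin{ -\!\!<}$R: as the $\mathbf{LBiI}$ rules with all principal and side formulas labelled by the same $x$ and tree $G$ unchanged; $\supset$R ($y\notin\mathrm{nodes}(G)$): $\Gamma,y:A\vdash_{G\oplus_x(x,y)}y:B,\Delta\Rightarrow\Gamma\vdash_G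 x:A\supset B,\Delta$; $\mathbin{ -\!\!<}$L ($y\notin\mathrm{nodes}(G)$): $\Gamma,y:A\vdash_{(y,x)\oplus_x G}y:B,\Delta\Rightarrow\Gamma,x:A\mathbin{ -\!\!<}B\vdash_G\Delta$. -}

module Defs where

open import Data.Nat using (ℕ; _≟_)
open import Data.Bool using (if_then_else_)
open import Data.Product using (_×_; _,_; ∃; proj₂)
open import Data.List using (List; []; _∷_; _++_; map)
open import Data.List.Membership.Propositional using (_∈_; _∉_)
open import Data.List.Relation.Unary.All using (All)
open import Data.List.Relation.Unary.Unique.Propositional using (Unique)
open import Data.List.Relation.Binary.Permutation.Propositional using (_↭_)
open import Relation.Nullary using (¬_)
open import Relation.Nullary.Decidable using (⌊_⌋)
open import Relation.Binary.PropositionalEquality using (_≡_)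
open import Function.Bundles using (_⇔_)

infixr 6 _∧ᶠ_
infixr 5 _∨ᶠ_
infixr 4 _⊃_ _−<_

data Formula : Set where
  var   : ℕ → Formula
  top   : Formula
  bot   : Formula
  _∧ᶠ_  : Formula → Formula → Formula
  _∨ᶠ_  : Formula → Formula → Formula
  _⊃_   : Formula → Formula → Formula
  _−<_  : Formula → Formula → Formula

-- LBiI.  Multisets are lists taken up to permutation (rule exch).
-- "Γ , A" is written  A ∷ Γ.

infix 2 _⊢_

data _⊢_ : List Formula → List Formula → Set where
  hyp    : ∀ {Γ Δ A} → A ∷ Γ ⊢ A ∷ Δ
  cut    : ∀ {Γ Δ A} → Γ ⊢ A ∷ Δ → A ∷ Γ ⊢ Δ → Γ ⊢ Δ
  weakL  : ∀ {Γ Δ A} → Γ ⊢ Δ → A ∷ Γ ⊢ Δ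
  weakR  : ∀ {Γ Δ A} → Γ ⊢ Δ → Γ ⊢ A ∷ Δ
  contrL : ∀ {Γ Δ A} → A ∷ A ∷ Γ ⊢ Δ → A ∷ Γ ⊢ Δ
  contrR : ∀ {Γ Δ A} → Γ ⊢ A ∷ A ∷ Δ → Γ ⊢ A ∷ Δ
  ⊤L     : ∀ {Γ Δ} → Γ ⊢ Δ → top ∷ Γ ⊢ Δ
  ⊤R     : ∀ {Γ Δ} → Γ ⊢ top ∷ Δ
  ⊥L     : ∀ {Γ Δ} → bot ∷ Γ ⊢ Δ
  ⊥R     : ∀ {Γ Δ} → Γ ⊢ Δ → Γ ⊢ bot ∷ Δ
  ∧L     : ∀ {Γ Δ A B} → A ∷ B ∷ Γ ⊢ Δ → (A ∧ᶠ B) ∷ Γ ⊢ Δ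
  ∧R     : ∀ {Γ Δ A B} → Γ ⊢ A ∷ Δ → Γ ⊢ B ∷ Δ → Γ ⊢ (A ∧ᶠ B) ∷ Δ
  ∨L     : ∀ {Γ Δ A B} → A ∷ Γ ⊢ Δ → B ∷ Γ ⊢ Δ → (A ∨ᶠ B) ∷ Γ ⊢ Δ
  ∨R     : ∀ {Γ Δ A B} → Γ ⊢ A ∷ B ∷ Δ → Γ ⊢ (A ∨ᶠ B) ∷ Δ
  ⊃L     : ∀ {Γ Δ A B} → (A ⊃ B) ∷ Γ ⊢ A ∷ Δ → B ∷ Γ ⊢ Δ → (A ⊃ B) ∷ Γ ⊢ Δ
  ⊃R     : ∀ {Γ Δ A B} → A ∷ Γ ⊢ B ∷ [] → Γ ⊢ (A ⊃ B) ∷ Δ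
  −<L    : ∀ {Γ Δ A B} → A ∷ [] ⊢ B ∷ Δ → (A −< B) ∷ Γ ⊢ Δ
  −<R    : ∀ {Γ Δ A B} → Γ ⊢ A ∷ Δ → B ∷ Γ ⊢ (A −< B) ∷ Δ → Γ ⊢ (A −< B) ∷ Δ
  exch   : ∀ {Γ Γ′ Δ Δ′} → Γ ↭ Γ′ → Δ ↭ Δ′ → Γ ⊢ Δ → Γ′ ⊢ Δ′

-- Label trees.  Nodes are natural numbers; a graph is given by its node
-- set and arc set, each represented by a list (taken up to membership).

record Graph : Set where
  constructor graph
  field
    nodes : List ℕ
    arcs  : List (ℕ × ℕ)
open Graph public

_─[_]→_ : ℕ → Graph → ℕ → Set
x ─[ G ]→ y = (x , y) ∈ arcs G

data Dir : Set where
  fwd bwd : Dir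

Step : Set
Step = Dir × (ℕ × ℕ)

start : Step → ℕ
start (fwd , (a , b)) = a
start (bwd , (a , b)) = b

end : Step → ℕ
end (fwd , (a , b)) = b
end (bwd , (a , b)) = a

data Walk (G : Graph) : ℕ → ℕ → List Step → Set where
  []  : ∀ {x} → Walk G x x []
  _∷_ : ∀ {x y d a b ss} → (a , b) ∈ arcs G → start (d , (a , b)) ≡ x →
        Walk G (end (d , (a , b))) y ss → Walk G x y ((d , (a , b)) ∷ ss)

Path : Graph → ℕ → ℕ → List Step → Set
Path G x y ss = Walk G x y ss × Unique (map proj₂ ss)

IsLabelTree : Graph → Set
IsLabelTree G =
  ∃ (λ x → x ∈ nodes G) ×
  (∀ {a b} → (a , b) ∈ arcs G → a ∈ nodes G × b ∈ nodes G) ×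
  (∀ x y → x ∈ nodes G → y ∈ nodes G →
     ∃ λ p → Path G x y p × (∀ q → Path G x y q → q ≡ p))

_≅_ : Graph → Graph → Set
G ≅ H = (∀ z → (z ∈ nodes G) ⇔ (z ∈ nodes H)) ×
        (∀ a → (a ∈ arcs G) ⇔ (a ∈ arcs H))

⟨_⟩ : ℕ → Graph
⟨ x ⟩ = graph (x ∷ []) []

⟨_⟶_⟩ : ℕ → ℕ → Graph
⟨ x ⟶ y ⟩ = graph (x ∷ y ∷ []) ((x , y) ∷ [])

-- G ⊕[ x ] H is the union; well-definedness proviso is  Glue x G H
infixl 5 _⊕[_]_
_⊕[_]_ : Graph → ℕ → Graph → Graph
G ⊕[ x ] H = graph (nodes G ++ nodes H) (arcs G ++ arcs H)

Glue : ℕ → Graph → Graph → Set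
Glue x G H = x ∈ nodes G × x ∈ nodes H ×
             (∀ z → z ∈ nodes G → z ∈ nodes H → z ≡ x)

rn : ℕ → ℕ → ℕ → ℕ
rn y x z = if ⌊ z ≟ x ⌋ then y else z

_[_/_]g : Graph → ℕ → ℕ → Graph
G [ y / x ]g = graph (map (rn y x) (nodes G))
                     (map (λ { (a , b) → (rn y x a , rn y x b) }) (arcs G))

infix 7 _∶_
record LFormula : Set where
  constructor _∶_
  field
    label   : ℕ
    formula : Formula
open LFormula public

_∶*_ : ℕ → List Formula → List LFormula
x ∶* Γ = map (x ∶_) Γ

_[_/_]l : List LFormula → ℕ → ℕ → List LFormula
Γ [ y / x ]l = map (λ { (z ∶ A) → rn y x z ∶ A }) Γ

WF : List LFormula → Graph → List LFormula → Set
WF Γ G Δ = IsLabelTree G ×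
           All (λ l → label l ∈ nodes G) Γ × All (λ l → label l ∈ nodes G) Δ

-- L-LBiI.  Every rule requires its conclusion to be a (well-formed)
-- labelled sequent; ⊕-well-definedness provisos are explicit (Glue).

infix 2 _⊢[_]_

data _⊢[_]_ : List LFormula → Graph → List LFormula → Set where
  hyp    : ∀ {Γ Δ G x A} → WF ((x ∶ A) ∷ Γ) G ((x ∶ A) ∷ Δ) →
           (x ∶ A) ∷ Γ ⊢[ G ] (x ∶ A) ∷ Δ
  cut    : ∀ {Γ Δ G x A} → WF Γ G Δ →
           Γ ⊢[ G ] (x ∶ A) ∷ Δ → (x ∶ A) ∷ Γ ⊢[ G ] Δ → Γ ⊢[ G ] Δ
  weakL  : ∀ {Γ Δ G a} → WF (a ∷ Γ) G Δ → Γ ⊢[ G ] Δ → a ∷ Γ ⊢[ G ] Δ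
  weakR  : ∀ {Γ Δ G a} → WF Γ G (a ∷ Δ) → Γ ⊢[ G ] Δ → Γ ⊢[ G ] a ∷ Δ
  contrL : ∀ {Γ Δ G a} → WF (a ∷ Γ) G Δ → a ∷ a ∷ Γ ⊢[ G ] Δ → a ∷ Γ ⊢[ G ] Δ
  contrR : ∀ {Γ Δ G a} → WF Γ G (a ∷ Δ) → Γ ⊢[ G ] a ∷ a ∷ Δ → Γ ⊢[ G ] a ∷ Δ
  nodesplitU : ∀ {Γ Δ G₀ G x y} →
           (∀ z → ¬ (z ─[ G ]→ x)) →
           Glue y G₀ ⟨ y ⟶ x ⟩ → Glue x (G₀ ⊕[ y ] ⟨ y ⟶ x ⟩) G →
           Glue y G₀ (G [ y / x ]g) →
           WF Γ ((G₀ ⊕[ y ] ⟨ y ⟶ x ⟩) ⊕[ x ] G) Δ →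
           Γ ⊢[ G₀ ⊕[ y ] (G [ y / x ]g) ] Δ →
           Γ ⊢[ (G₀ ⊕[ y ] ⟨ y ⟶ x ⟩) ⊕[ x ] G ] Δ
  nodesplitD : ∀ {Γ Δ G₀ G x y} →
           (∀ z → ¬ (x ─[ G ]→ z)) →
           Glue x G ⟨ x ⟶ y ⟩ → Glue y (G ⊕[ x ] ⟨ x ⟶ y ⟩) G₀ →
           Glue y (G [ y / x ]g) G₀ →
           WF Γ ((G ⊕[ x ] ⟨ x ⟶ y ⟩) ⊕[ y ] G₀) Δ →
           Γ ⊢[ (G [ y / x ]g) ⊕[ y ] G₀ ] Δ →
           Γ ⊢[ (G ⊕[ x ] ⟨ x ⟶ y ⟩) ⊕[ y ] G₀ ] Δ
  nodemergeD : ∀ {Γ Δ G₀ G x y} →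
           Glue y G₀ ⟨ y ⟶ x ⟩ → Glue x (G₀ ⊕[ y ] ⟨ y ⟶ x ⟩) G →
           Glue x (G₀ [ x / y ]g) G →
           WF (Γ [ x / y ]l) ((G₀ [ x / y ]g) ⊕[ x ] G) (Δ [ x / y ]l) →
           Γ ⊢[ (G₀ ⊕[ y ] ⟨ y ⟶ x ⟩) ⊕[ x ] G ] Δ →
           Γ [ x / y ]l ⊢[ (G₀ [ x / y ]g) ⊕[ x ] G ] Δ [ x / y ]l
  nodemergeU : ∀ {Γ Δ G₀ G x y} →
           Glue x G ⟨ x ⟶ y ⟩ → Glue y (G ⊕[ x ] ⟨ x ⟶ y ⟩) G₀ →
           Glue x G (G₀ [ x / y ]g) →
           WF (Γ [ x / y ]l) (G ⊕[ x ] (G₀ [ x / y ]g)) (Δ [ x / y ]l) →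
           Γ ⊢[ (G ⊕[ x ] ⟨ x ⟶ y ⟩) ⊕[ y ] G₀ ] Δ →
           Γ [ x / y ]l ⊢[ G ⊕[ x ] (G₀ [ x / y ]g) ] Δ [ x / y ]l
  monotL : ∀ {Γ Δ G x y A} → x ─[ G ]→ y → WF ((x ∶ A) ∷ Γ) G Δ →
           (x ∶ A) ∷ (y ∶ A) ∷ Γ ⊢[ G ] Δ → (x ∶ A) ∷ Γ ⊢[ G ] Δ
  monotR : ∀ {Γ Δ G x y A} → y ─[ G ]→ x → WF Γ G ((x ∶ A) ∷ Δ) →
           Γ ⊢[ G ] (y ∶ A) ∷ (x ∶ A) ∷ Δ → Γ ⊢[ G ] (x ∶ A) ∷ Δ
  ⊤L     : ∀ {Γ Δ G x} → WF ((x ∶ top) ∷ Γ) G Δ →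
           Γ ⊢[ G ] Δ → (x ∶ top) ∷ Γ ⊢[ G ] Δ
  ⊤R     : ∀ {Γ Δ G x} → WF Γ G ((x ∶ top) ∷ Δ) → Γ ⊢[ G ] (x ∶ top) ∷ Δ
  ⊥L     : ∀ {Γ Δ G x} → WF ((x ∶ bot) ∷ Γ) G Δ → (x ∶ bot) ∷ Γ ⊢[ G ] Δ
  ⊥R     : ∀ {Γ Δ G x} → WF Γ G ((x ∶ bot) ∷ Δ) →
           Γ ⊢[ G ] Δ → Γ ⊢[ G ] (x ∶ bot) ∷ Δ
  ∧L     : ∀ {Γ Δ G x A B} → WF ((x ∶ (A ∧ᶠ B)) ∷ Γ) G Δ →
           (x ∶ A) ∷ (x ∶ B) ∷ Γ ⊢[ G ] Δ → (x ∶ (A ∧ᶠ B)) ∷ Γ ⊢[ G ] Δ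
  ∧R     : ∀ {Γ Δ G x A B} → WF Γ G ((x ∶ (A ∧ᶠ B)) ∷ Δ) →
           Γ ⊢[ G ] (x ∶ A) ∷ Δ → Γ ⊢[ G ] (x ∶ B) ∷ Δ →
           Γ ⊢[ G ] (x ∶ (A ∧ᶠ B)) ∷ Δ
  ∨L     : ∀ {Γ Δ G x A B} → WF ((x ∶ (A ∨ᶠ B)) ∷ Γ) G Δ →
           (x ∶ A) ∷ Γ ⊢[ G ] Δ → (x ∶ B) ∷ Γ ⊢[ G ] Δ →
           (x ∶ (A ∨ᶠ B)) ∷ Γ ⊢[ G ] Δ
  ∨R     : ∀ {Γ Δ G x A B} → WF Γ G ((x ∶ (A ∨ᶠ B)) ∷ Δ) →
           Γ ⊢[ G ] (x ∶ A) ∷ (x ∶ B) ∷ Δ → Γ ⊢[ G ] (x ∶ (A ∨ᶠ B)) ∷ Δ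
  ⊃L     : ∀ {Γ Δ G x A B} → WF ((x ∶ (A ⊃ B)) ∷ Γ) G Δ →
           (x ∶ (A ⊃ B)) ∷ Γ ⊢[ G ] (x ∶ A) ∷ Δ → (x ∶ B) ∷ Γ ⊢[ G ] Δ →
           (x ∶ (A ⊃ B)) ∷ Γ ⊢[ G ] Δ
  ⊃R     : ∀ {Γ Δ G x y A B} → y ∉ nodes G → Glue x G ⟨ x ⟶ y ⟩ →
           WF Γ G ((x ∶ (A ⊃ B)) ∷ Δ) →
           (y ∶ A) ∷ Γ ⊢[ G ⊕[ x ] ⟨ x ⟶ y ⟩ ] (y ∶ B) ∷ Δ →
           Γ ⊢[ G ] (x ∶ (A ⊃ B)) ∷ Δ
  −<L    : ∀ {Γ Δ G x y A B} → y ∉ nodes G → Glue x ⟨ y ⟶ x ⟩ G →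
           WF ((x ∶ (A −< B)) ∷ Γ) G Δ →
           (y ∶ A) ∷ Γ ⊢[ ⟨ y ⟶ x ⟩ ⊕[ x ] G ] (y ∶ B) ∷ Δ →
           (x ∶ (A −< B)) ∷ Γ ⊢[ G ] Δ
  −<R    : ∀ {Γ Δ G x A B} → WF Γ G ((x ∶ (A −< B)) ∷ Δ) →
           Γ ⊢[ G ] (x ∶ A) ∷ Δ → (x ∶ B) ∷ Γ ⊢[ G ] (x ∶ (A −< B)) ∷ Δ →
           Γ ⊢[ G ] (x ∶ (A −< B)) ∷ Δ
  -- multisets / graphs are taken up to representation
  exch   : ∀ {Γ Γ′ Δ Δ′ G} → Γ ↭ Γ′ → Δ ↭ Δ′ → Γ ⊢[ G ] Δ → Γ′ ⊢[ G ] Δ′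
  graphEq : ∀ {Γ Δ G H} → G ≅ H → Γ ⊢[ G ] Δ → Γ ⊢[ H ] Δ

-- Every LBiI rule except ⊃R and −<L is its own labelled version at the single node x.  For
-- ⊃R and −<L the premise is translated at a fresh node y; a nodesplit grows ⟨ y ⟩ into the
-- two-node tree x → y (resp. y → x) demanded by the labelled rule, and monotonicity along
-- the new arc moves the side formulas from y back to x.
module Submission where

open import Defs
open import Data.Nat using (ℕ; suc; _≟_)
open import Data.Nat.Properties using (1+n≢n)
open import Data.List using (List; []; _∷_; _++_; [_])
open import Data.List.Membership.Propositional using (_∈_; _∉_)
open import Data.List.Relation.Unary.Any using (here; there)
open import Data.List.Relation.Unary.All as All using (All; []; _∷_)
open import Data.List.Relation.Unary.All.Properties using (++⁺; map⁺)
open import Data.List.Relation.Unary.AllPairs using ([]; _∷_)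
open import Data.List.Relation.Binary.Permutation.Propositional using (↭-refl; ↭-sym; swap)
import Data.List.Relation.Binary.Permutation.Propositional.Properties as ↭
open import Data.Product using (_×_; _,_; ∃; proj₁; proj₂)
open import Data.Sum using (_⊎_; inj₁; inj₂)
open import Data.Empty using (⊥-elim)
open import Relation.Nullary using (¬_; yes; no)
open import Relation.Binary.PropositionalEquality using (_≡_; refl; sym; trans; cong; _≢_)
open import Function using (id; _∘_)
open import Function.Bundles using (mk⇔)

rn-self : ∀ y x → rn y x x ≡ y
rn-self y x with x ≟ x
... | yes _   = refl
... | no x≢x = ⊥-elim (x≢x refl)

walk-nil : ∀ {G u v} → Walk G u v [] → u ≡ v
walk-nil [] = refl

walk-single : ∀ {G u v s} → Walk G u v (s ∷ []) → start s ≡ u × end s ≡ v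
walk-single (_∷_ _ st []) = st , refl

⟨⟩-isLabelTree : ∀ x → IsLabelTree ⟨ x ⟩
⟨⟩-isLabelTree x = (x , here refl) , (λ ()) , connect
  where
  only-nil : ∀ {q} → Path ⟨ x ⟩ x x q → q ≡ []
  only-nil ([] , _)          = refl
  only-nil (_∷_ () _ _ , _)

  connect : ∀ u v → u ∈ nodes ⟨ x ⟩ → v ∈ nodes ⟨ x ⟩ →
            ∃ λ p → Path ⟨ x ⟩ u v p × (∀ q → Path ⟨ x ⟩ u v q → q ≡ p)
  connect u v (here refl) (here refl) = [] , ([] , []) , λ _ → only-nil

Enumerates₂ : ℕ → ℕ → List ℕ → Set
Enumerates₂ a b ns = a ∈ ns × b ∈ ns × All (λ z → z ≡ a ⊎ z ≡ b) ns

enumerates₂-⊆ : ∀ {a b ns ms z} → Enumerates₂ a b ns → Enumerates₂ a b ms → z ∈ ns → z ∈ ms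
enumerates₂-⊆ (_ , _ , ns⊆) (a∈ , b∈ , _) z∈ with All.lookup ns⊆ z∈
... | inj₁ refl = a∈
... | inj₂ refl = b∈

enumerates₂-≅ : ∀ {a b ns ms es} → Enumerates₂ a b ns → Enumerates₂ a b ms →
                graph ns es ≅ graph ms es
enumerates₂-≅ ns≈ ms≈ =
  (λ _ → mk⇔ (enumerates₂-⊆ ns≈ ms≈) (enumerates₂-⊆ ms≈ ns≈)) , (λ _ → mk⇔ id id)

module _ {a b ns} (a≢b : a ≢ b) (ns≈ : Enumerates₂ a b ns) where

  private
    G : Graph
    G = graph ns ((a , b) ∷ [])

  -- A path cannot use the only arc twice.
  path-length≤1 : ∀ {u v q} → Path G u v q → q ≡ [] ⊎ ∃ λ d → q ≡ (d , (a , b)) ∷ []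
  path-length≤1 ([] , _) = inj₁ refl
  path-length≤1 (_∷_ (here refl) _ [] , _) = inj₂ (_ , refl)
  path-length≤1 (_∷_ (here refl) _ (_∷_ (here refl) _ _) , (ab≢ab ∷ _) ∷ _) = ⊥-elim (ab≢ab refl)
  path-length≤1 (_∷_ (here refl) _ (_∷_ (there ()) _ _) , _)
  path-length≤1 (_∷_ (there ()) _ _ , _)

  start≢end : ∀ d → start (d , (a , b)) ≢ end (d , (a , b))
  start≢end fwd = a≢b
  start≢end bwd = a≢b ∘ sym

  start-injective : ∀ d d′ → start (d , (a , b)) ≡ start (d′ , (a , b)) → d ≡ d′
  start-injective fwd fwd _  = refl
  start-injective bwd bwd _  = refl
  start-injective fwd bwd eq = ⊥-elim (a≢b eq)
  start-injective bwd fwd eq = ⊥-elim (a≢b (sym eq))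

  no-single-loop : ∀ {u d} → ¬ Walk G u u ((d , (a , b)) ∷ [])
  no-single-loop {d = d} w = let s , e = walk-single w in start≢end d (trans s (sym e))

  path-unique : ∀ {u v p q} → Path G u v p → Path G u v q → p ≡ q
  path-unique P Q with path-length≤1 P | path-length≤1 Q
  ... | inj₁ refl | inj₁ refl = refl
  ... | inj₁ refl | inj₂ (_ , refl) with refl ← walk-nil (proj₁ P) = ⊥-elim (no-single-loop (proj₁ Q))
  ... | inj₂ (_ , refl) | inj₁ refl with refl ← walk-nil (proj₁ Q) = ⊥-elim (no-single-loop (proj₁ P))
  ... | inj₂ (d , refl) | inj₂ (d′ , refl) =
    cong (λ d → (d , (a , b)) ∷ [])
      (start-injective d d′
        (trans (proj₁ (walk-single (proj₁ P))) (sym (proj₁ (walk-single (proj₁ Q))))))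

  path-exists : ∀ {u v} → u ≡ a ⊎ u ≡ b → v ≡ a ⊎ v ≡ b → ∃ (Path G u v)
  path-exists (inj₁ refl) (inj₁ refl) = [] , [] , []
  path-exists (inj₁ refl) (inj₂ refl) = (fwd , (a , b)) ∷ [] , _∷_ (here refl) refl [] , [] ∷ []
  path-exists (inj₂ refl) (inj₁ refl) = (bwd , (a , b)) ∷ [] , _∷_ (here refl) refl [] , [] ∷ []
  path-exists (inj₂ refl) (inj₂ refl) = [] , [] , []

  arc-isLabelTree : IsLabelTree G
  arc-isLabelTree = (a , a∈) , arc-ends , connect
    where
    a∈ : a ∈ ns
    a∈ = proj₁ ns≈
    ns⊆ : All (λ z → z ≡ a ⊎ z ≡ b) ns
    ns⊆ = proj₂ (proj₂ ns≈)

    arc-ends : ∀ {c e} → (c , e) ∈ arcs G → c ∈ ns × e ∈ ns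
    arc-ends (here refl) = a∈ , proj₁ (proj₂ ns≈)

    connect : ∀ u v → u ∈ ns → v ∈ ns →
              ∃ λ p → Path G u v p × (∀ q → Path G u v q → q ≡ p)
    connect u v u∈ v∈ =
      let p , P = path-exists (All.lookup ns⊆ u∈) (All.lookup ns⊆ v∈) in
      p , P , λ q Q → path-unique Q P

LabelsIn : List ℕ → List LFormula → Set
LabelsIn ns Γ = All (λ l → label l ∈ ns) Γ

labelsIn-∶* : ∀ {ns x} → x ∈ ns → ∀ Γ → LabelsIn ns (x ∶* Γ)
labelsIn-∶* x∈ Γ = map⁺ (All.universal (λ _ → x∈) Γ)

labelsIn-⟨⟩ : ∀ {ns x Γ} → x ∈ ns → LabelsIn (x ∷ []) Γ → LabelsIn ns Γ
labelsIn-⟨⟩ x∈ = All.map λ { (here refl) → x∈ }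

wf-⟨⟩ : ∀ x Γ Δ → WF (x ∶* Γ) ⟨ x ⟩ (x ∶* Δ)
wf-⟨⟩ x Γ Δ = ⟨⟩-isLabelTree x , labelsIn-∶* (here refl) Γ , labelsIn-∶* (here refl) Δ

glue-⟨⟩ˡ : ∀ {x} G → x ∈ nodes G → Glue x ⟨ x ⟩ G
glue-⟨⟩ˡ _ x∈ = here refl , x∈ , λ { _ (here refl) _ → refl }

glue-⟨⟩ʳ : ∀ {x} G → x ∈ nodes G → Glue x G ⟨ x ⟩
glue-⟨⟩ʳ _ x∈ = x∈ , here refl , λ { _ _ (here refl) → refl }

module _ {G} (T : IsLabelTree G) where

  weakL* : ∀ {Π Σ} Θ → LabelsIn (nodes G) Π → LabelsIn (nodes G) Σ → LabelsIn (nodes G) Θ →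
           Π ⊢[ G ] Σ → Π ++ Θ ⊢[ G ] Σ
  weakL* {Π} {Σ} Θ lΠ lΣ lΘ d = exch (↭.++-comm Θ Π) ↭-refl (weaken Θ lΘ)
    where
    weaken : ∀ Θ → LabelsIn (nodes G) Θ → Θ ++ Π ⊢[ G ] Σ
    weaken []      []        = d
    weaken (l ∷ Θ) (lₗ ∷ lΘ) = weakL (T , lₗ ∷ ++⁺ lΘ lΠ , lΣ) (weaken Θ lΘ)

  weakR* : ∀ {Π Σ} Θ → LabelsIn (nodes G) Π → LabelsIn (nodes G) Σ → LabelsIn (nodes G) Θ →
           Π ⊢[ G ] Σ → Π ⊢[ G ] Σ ++ Θ
  weakR* {Π} {Σ} Θ lΠ lΣ lΘ d = exch ↭-refl (↭.++-comm Θ Σ) (weaken Θ lΘ)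
    where
    weaken : ∀ Θ → LabelsIn (nodes G) Θ → Π ⊢[ G ] Θ ++ Σ
    weaken []      []        = d
    weaken (l ∷ Θ) (lₗ ∷ lΘ) = weakR (T , lΠ , lₗ ∷ ++⁺ lΘ lΣ) (weaken Θ lΘ)

  module _ {x y} (x∈ : x ∈ nodes G) (y∈ : y ∈ nodes G) where

    monotL* : ∀ {Δ} → x ─[ G ]→ y → LabelsIn (nodes G) Δ → ∀ Π Γ → LabelsIn (nodes G) Π →
              Π ++ y ∶* Γ ⊢[ G ] Δ → Π ++ x ∶* Γ ⊢[ G ] Δ
    monotL* xy lΔ Π []      lΠ d = d
    monotL* xy lΔ Π (C ∷ Γ) lΠ d =
      exch (↭-sym (↭.shift (x ∶ C) Π (x ∶* Γ))) ↭-refl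
        (monotL* xy lΔ ((x ∶ C) ∷ Π) Γ (x∈ ∷ lΠ)
          (monotL xy (T , x∈ ∷ lrest , lΔ)
            (weakL (T , x∈ ∷ y∈ ∷ lrest , lΔ)
              (exch (↭.shift (y ∶ C) Π (y ∶* Γ)) ↭-refl d))))
      where
      lrest : LabelsIn (nodes G) (Π ++ y ∶* Γ)
      lrest = ++⁺ lΠ (labelsIn-∶* y∈ Γ)

    monotR* : ∀ {Γ} → y ─[ G ]→ x → LabelsIn (nodes G) Γ → ∀ Σ Δ → LabelsIn (nodes G) Σ →
              Γ ⊢[ G ] Σ ++ y ∶* Δ → Γ ⊢[ G ] Σ ++ x ∶* Δ
    monotR* yx lΓ Σ []      lΣ d = d
    monotR* yx lΓ Σ (C ∷ Δ) lΣ d =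
      exch ↭-refl (↭-sym (↭.shift (x ∶ C) Σ (x ∶* Δ)))
        (monotR* yx lΓ ((x ∶ C) ∷ Σ) Δ (x∈ ∷ lΣ)
          (monotR yx (T , lΓ , x∈ ∷ lrest)
            (exch ↭-refl (swap _ _ ↭-refl)
              (weakR (T , lΓ , x∈ ∷ y∈ ∷ lrest)
                (exch ↭-refl (↭.shift (y ∶ C) Σ (y ∶* Δ)) d)))))
      where
      lrest : LabelsIn (nodes G) (Σ ++ y ∶* Δ)
      lrest = ++⁺ lΣ (labelsIn-∶* y∈ Δ)

⊕⟨⟶⟩-enumerates₂ : ∀ x y → Enumerates₂ x y (nodes (⟨ x ⟩ ⊕[ x ] ⟨ x ⟶ y ⟩))
⊕⟨⟶⟩-enumerates₂ x y = here refl , there (there (here refl)) , inj₁ refl ∷ inj₁ refl ∷ inj₂ refl ∷ []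

⟨⟶⟩⊕-enumerates₂ : ∀ x y → Enumerates₂ y x (nodes (⟨ y ⟶ x ⟩ ⊕[ x ] ⟨ x ⟩))
⟨⟶⟩⊕-enumerates₂ x y = here refl , there (here refl) , inj₁ refl ∷ inj₂ refl ∷ inj₂ refl ∷ []

⟨⟩-enumerates₂ : ∀ y → Enumerates₂ y y (nodes ⟨ y ⟩)
⟨⟩-enumerates₂ y = here refl , here refl , inj₁ refl ∷ []

module _ {Π Σ x y} (x≢y : x ≢ y) (lΠ : LabelsIn (y ∷ []) Π) (lΣ : LabelsIn (y ∷ []) Σ) where

  nodesplitD-⟨⟩ : Π ⊢[ ⟨ y ⟩ ] Σ → Π ⊢[ ⟨ x ⟩ ⊕[ x ] ⟨ x ⟶ y ⟩ ] Σ
  nodesplitD-⟨⟩ d =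
    graphEq (enumerates₂-≅ split≈ (⊕⟨⟶⟩-enumerates₂ x y))
      (nodesplitD {G₀ = ⟨ y ⟩} {G = ⟨ x ⟩} (λ _ ())
        (glue-⟨⟩ˡ ⟨ x ⟶ y ⟩ (here refl))
        (glue-⟨⟩ʳ (⟨ x ⟩ ⊕[ x ] ⟨ x ⟶ y ⟩) (there (there (here refl))))
        (glue-⟨⟩ʳ (⟨ x ⟩ [ y / x ]g) (here (sym (rn-self y x))))
        (arc-isLabelTree x≢y split≈ , labelsIn-⟨⟩ y∈ lΠ , labelsIn-⟨⟩ y∈ lΣ)
        (graphEq (enumerates₂-≅ (⟨⟩-enumerates₂ y) renamed≈) d))
    where
    y∈ : y ∈ x ∷ x ∷ y ∷ y ∷ []
    y∈ = there (there (here refl))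
    renamed≈ : Enumerates₂ y y (rn y x x ∷ y ∷ [])
    renamed≈ = there (here refl) , there (here refl) , inj₁ (rn-self y x) ∷ inj₁ refl ∷ []
    split≈ : Enumerates₂ x y (x ∷ x ∷ y ∷ y ∷ [])
    split≈ = here refl , y∈ , inj₁ refl ∷ inj₁ refl ∷ inj₂ refl ∷ inj₂ refl ∷ []

  nodesplitU-⟨⟩ : Π ⊢[ ⟨ y ⟩ ] Σ → Π ⊢[ ⟨ y ⟶ x ⟩ ⊕[ x ] ⟨ x ⟩ ] Σ
  nodesplitU-⟨⟩ d =
    graphEq (enumerates₂-≅ split≈ (⟨⟶⟩⊕-enumerates₂ x y))
      (nodesplitU {G₀ = ⟨ y ⟩} {G = ⟨ x ⟩} (λ _ ())
        (glue-⟨⟩ˡ ⟨ y ⟶ x ⟩ (here refl))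
        (glue-⟨⟩ʳ (⟨ y ⟩ ⊕[ y ] ⟨ y ⟶ x ⟩) (there (there (here refl))))
        (glue-⟨⟩ˡ (⟨ x ⟩ [ y / x ]g) (here (sym (rn-self y x))))
        (arc-isLabelTree (x≢y ∘ sym) split≈ ,
         labelsIn-⟨⟩ (here refl) lΠ , labelsIn-⟨⟩ (here refl) lΣ)
        (graphEq (enumerates₂-≅ (⟨⟩-enumerates₂ y) renamed≈) d))
    where
    renamed≈ : Enumerates₂ y y (y ∷ rn y x x ∷ [])
    renamed≈ = here refl , here refl , inj₁ refl ∷ inj₁ (rn-self y x) ∷ []
    split≈ : Enumerates₂ y x (y ∷ y ∷ x ∷ x ∷ [])
    split≈ = here refl , there (there (here refl)) ,
             inj₁ refl ∷ inj₁ refl ∷ inj₂ refl ∷ inj₂ refl ∷ []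

module _ (x : ℕ) where

  private
    y : ℕ
    y = suc x

    x≢y : x ≢ y
    x≢y = 1+n≢n ∘ sym

    y∉ : y ∉ nodes ⟨ x ⟩
    y∉ (here y≡x) = 1+n≢n y≡x

  ⊃R-⟨⟩ : ∀ Γ Δ A B → (y ∶ A) ∷ y ∶* Γ ⊢[ ⟨ y ⟩ ] (y ∶ B) ∷ [] →
          x ∶* Γ ⊢[ ⟨ x ⟩ ] (x ∶ (A ⊃ B)) ∷ x ∶* Δ
  ⊃R-⟨⟩ Γ Δ A B d =
    ⊃R y∉ (glue-⟨⟩ˡ ⟨ x ⟶ y ⟩ (here refl)) (wf-⟨⟩ x Γ ((A ⊃ B) ∷ Δ))
      (weakR* T (x ∶* Δ) (y∈ ∷ labelsIn-∶* x∈ Γ) (y∈ ∷ []) (labelsIn-∶* x∈ Δ)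
        (monotL* T x∈ y∈ (here refl) (y∈ ∷ []) [ y ∶ A ] Γ (y∈ ∷ [])
          (nodesplitD-⟨⟩ x≢y (labelsIn-∶* (here refl) (A ∷ Γ)) (here refl ∷ []) d)))
    where
    T : IsLabelTree (⟨ x ⟩ ⊕[ x ] ⟨ x ⟶ y ⟩)
    T = arc-isLabelTree x≢y (⊕⟨⟶⟩-enumerates₂ x y)
    x∈ : x ∈ x ∷ x ∷ y ∷ []
    x∈ = here refl
    y∈ : y ∈ x ∷ x ∷ y ∷ []
    y∈ = there (there (here refl))

  −<L-⟨⟩ : ∀ Γ Δ A B → (y ∶ A) ∷ [] ⊢[ ⟨ y ⟩ ] (y ∶ B) ∷ y ∶* Δ →
           (x ∶ (A −< B)) ∷ x ∶* Γ ⊢[ ⟨ x ⟩ ] x ∶* Δ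
  −<L-⟨⟩ Γ Δ A B d =
    −<L y∉ (glue-⟨⟩ʳ ⟨ y ⟶ x ⟩ (there (here refl))) (wf-⟨⟩ x ((A −< B) ∷ Γ) Δ)
      (weakL* T (x ∶* Γ) (y∈ ∷ []) (y∈ ∷ labelsIn-∶* x∈ Δ) (labelsIn-∶* x∈ Γ)
        (monotR* T x∈ y∈ (here refl) (y∈ ∷ []) [ y ∶ B ] Δ (y∈ ∷ [])
          (nodesplitU-⟨⟩ x≢y (here refl ∷ []) (labelsIn-∶* (here refl) (B ∷ Δ)) d)))
    where
    T : IsLabelTree (⟨ y ⟶ x ⟩ ⊕[ x ] ⟨ x ⟩)
    T = arc-isLabelTree (x≢y ∘ sym) (⟨⟶⟩⊕-enumerates₂ x y)
    y∈ : y ∈ y ∷ x ∷ x ∷ []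
    y∈ = here refl
    x∈ : x ∈ y ∷ x ∷ x ∷ []
    x∈ = there (here refl)

embed : ∀ {Γ Δ} x → Γ ⊢ Δ → x ∶* Γ ⊢[ ⟨ x ⟩ ] x ∶* Δ
embed x (hyp {Γ} {Δ} {A})            = hyp (wf-⟨⟩ x (A ∷ Γ) (A ∷ Δ))
embed x (cut {Γ} {Δ} d e)            = cut (wf-⟨⟩ x Γ Δ) (embed x d) (embed x e)
embed x (weakL {Γ} {Δ} {A} d)        = weakL (wf-⟨⟩ x (A ∷ Γ) Δ) (embed x d)
embed x (weakR {Γ} {Δ} {A} d)        = weakR (wf-⟨⟩ x Γ (A ∷ Δ)) (embed x d)
embed x (contrL {Γ} {Δ} {A} d)       = contrL (wf-⟨⟩ x (A ∷ Γ) Δ) (embed x d)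
embed x (contrR {Γ} {Δ} {A} d)       = contrR (wf-⟨⟩ x Γ (A ∷ Δ)) (embed x d)
embed x (⊤L {Γ} {Δ} d)               = ⊤L (wf-⟨⟩ x (top ∷ Γ) Δ) (embed x d)
embed x (⊤R {Γ} {Δ})                 = ⊤R (wf-⟨⟩ x Γ (top ∷ Δ))
embed x (⊥L {Γ} {Δ})                 = ⊥L (wf-⟨⟩ x (bot ∷ Γ) Δ)
embed x (⊥R {Γ} {Δ} d)               = ⊥R (wf-⟨⟩ x Γ (bot ∷ Δ)) (embed x d)
embed x (∧L {Γ} {Δ} {A} {B} d)       = ∧L (wf-⟨⟩ x ((A ∧ᶠ B) ∷ Γ) Δ) (embed x d)
embed x (∧R {Γ} {Δ} {A} {B} d e)     = ∧R (wf-⟨⟩ x Γ ((A ∧ᶠ B) ∷ Δ)) (embed x d) (embed x e)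
embed x (∨L {Γ} {Δ} {A} {B} d e)     = ∨L (wf-⟨⟩ x ((A ∨ᶠ B) ∷ Γ) Δ) (embed x d) (embed x e)
embed x (∨R {Γ} {Δ} {A} {B} d)       = ∨R (wf-⟨⟩ x Γ ((A ∨ᶠ B) ∷ Δ)) (embed x d)
embed x (⊃L {Γ} {Δ} {A} {B} d e)     = ⊃L (wf-⟨⟩ x ((A ⊃ B) ∷ Γ) Δ) (embed x d) (embed x e)
embed x (⊃R {Γ} {Δ} {A} {B} d)       = ⊃R-⟨⟩ x Γ Δ A B (embed (suc x) d)
embed x (−<L {Γ} {Δ} {A} {B} d)      = −<L-⟨⟩ x Γ Δ A B (embed (suc x) d)
embed x (−<R {Γ} {Δ} {A} {B} d e)    = −<R (wf-⟨⟩ x Γ ((A −< B) ∷ Δ)) (embed x d) (embed x e)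
embed x (exch Γ↭Γ′ Δ↭Δ′ d)           =
  exch (↭.map⁺ (x ∶_) Γ↭Γ′) (↭.map⁺ (x ∶_) Δ↭Δ′) (embed x d)

mainTheorem5 : (Γ Δ : List Formula) (x : ℕ) →
               Γ ⊢ Δ → x ∶* Γ ⊢[ ⟨ x ⟩ ] x ∶* Δ
mainTheorem5 Γ Δ x = embed x
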